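{- Let $\mathcal{L}$ and $\mathcal{L}'$ be many-sorted signatures with $\mathcal{L}\leq\mathcal{L}'$, and let $\Gamma\cup\{\varphi\}$ be a set of well-sorted $\mathcal{L}$-formulas. If $\Gamma\vdash^{\mathcal{L}'}_{\mathrm{MSL}}\varphi$, then $\Gamma\vdash^{\mathcal{L}}_{\mathrm{MSL}}\varphi$.
   Context: A many-sorted signature $\mathcal{L}$ consists of a countable set $\mathrm{Rel}$ of relation symbols and a countable set $\mathrm{Fun}$ of function symbols with arities (0-ary function symbols are constants); a nonempty countable set $\mathrm{Sort}$; pairwise disjoint countably infinite sets $\mathrm{Var}_i$ of variables of sort $i$, written $x^i$; and $\mathrm{rank}$ assigning to each $n$-ary relation symbol $R$ a nonempty $\mathrm{rank}(R)\subseteq\mathrm{Sort}^n$ and to each $n$-ary function symbol $f$ a nonempty partial function $\mathrm{rank}(f)\subseteq\mathrm{Sort}^n\times\mathrm{Sort}$. Well-sorted terms: variables of $\mathrm{Var}_i$ have sort $i$; $f(t_1,\dots,t_n)$ has sort $i$ if the $t_k$ have sorts $i_k$ and $(i_1,\dots,i_n,i)\in\mathrm{rank}(f)$. Well-sorted formulas: $\bot$; $t_1=t_2$ for terms of the same sort; $R(t_1,\dots,t_n)$ when the tuple of sorts lies in $\mathrm{rank}(R)$; closure under $\land,\lor,\to,\exists x^i,\forall x^i$. $\mathcal{L}\leq\mathcal{L}'$ means: $\mathrm{Sort}\subseteq\mathrm{Sort}'$, $\mathrm{Var}_i=\mathrm{Var}'_i$ for each $i\in\mathrm{Sort}$, $\mathrm{Rel}\subseteq\mathrm{Rel}'$,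 $\mathrm{Fun}\subseteq\mathrm{Fun}'$, $\mathrm{rank}(R)\subseteq\mathrm{rank}'(R)$ for $R\in\mathrm{Rel}$, and $\mathrm{rank}(f)\subseteq\mathrm{rank}'(f)$ for $f\in\mathrm{Fun}$. $\Gamma\vdash^{\mathcal{L}}_{\mathrm{MSL}}\varphi$: derivability in classical natural deduction with sorted quantifier rules ($\forall E$, $\exists I$ instantiate a variable of sort $i$ only by well-sorted terms of sort $i$; usual eigenvariable conditions), where all formulas in the derivation are well-sorted $\mathcal{L}$-formulas, plus universal closures of the sorted equality axioms of $\mathcal{L}$ ($x^i=x^i$, symmetry and transitivity at each sort, $\bigwedge_k x_k^{i_k}=y_k^{i_k}\to(R(\vec x)\to R(\vec y))$ for $(i_1,\dots,i_n)\in\mathrm{rank}(R)$, $\bigwedge_k x_k^{i_k}=y_k^{i_k}\to f(\vec x)=f(\vec y)$ for $(i_1,\dots,i_n)$ in the domain of $\mathrm{rank}(f)$). -}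

module Defs where

open import Data.Nat using (ℕ; zero; suc; _+_; _*_)
open import Data.Nat using (_≟_)
open import Data.Product using (Σ; ∃; _×_; _,_; proj₁; proj₂)
import Data.Product.Properties
open import Data.Sum using (_⊎_; inj₁; inj₂)
open import Data.Unit using (⊤; tt)
open import Data.Empty using (⊥)
open import Data.List using (List; []; _∷_; length; zip)
open import Data.List.Relation.Unary.All using (All)
open import Data.List.Relation.Unary.Any using (Any)
open import Data.List.Membership.Propositional using (_∈_)
open import Data.List.Relation.Binary.Pointwise using (Pointwise)
open import Relation.Nullary using (¬_; Dec; yes; no)
open import Relation.Binary.PropositionalEquality using (_≡_; _≢_)

-- Sorts, relation symbols, function symbols are
-- coded by natural numbers (all sets in a signature are countable).
-- A relation / function symbol is a pair (arity , code).
-- A variable of sort i is a pair (i , n) : Var_i = {i} × ℕ, so the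
-- Var_i are pairwise disjoint and countably infinite, and they only
-- depend on i (hence Var_i = Var'_i whenever L ≤ L').

SortCode : Set
SortCode = ℕ

RelSym : Set
RelSym = ℕ × ℕ

FunSym : Set
FunSym = ℕ × ℕ

arity : ℕ × ℕ → ℕ
arity = proj₁

Var : Set
Var = SortCode × ℕ

sortOf : Var → SortCode
sortOf = proj₁

_≟v_ : (x y : Var) → Dec (x ≡ y)
_≟v_ = Data.Product.Properties.≡-dec _≟_ _≟_

record Signature : Set₁ where
  field
    Sort     : SortCode → Set
    Rel      : RelSym → Set
    Fun      : FunSym → Set
    rankR    : RelSym → List SortCode → Set
    rankF    : FunSym → List SortCode → SortCode → Set
    sort-nonempty  : ∃ Sort
    rankR-rel      : ∀ {R is} → rankR R is → Rel R
    rankR-arity    : ∀ {R is} → rankR R is → length is ≡ arity R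
    rankR-sorts    : ∀ {R is} → rankR R is → All Sort is
    rankR-nonempty : ∀ {R} → Rel R → ∃ (rankR R)
    -- rank(f) is a nonempty partial function Sort^n ⇀ Sort, for f ∈ Fun
    rankF-fun      : ∀ {f is i} → rankF f is i → Fun f
    rankF-arity    : ∀ {f is i} → rankF f is i → length is ≡ arity f
    rankF-sorts    : ∀ {f is i} → rankF f is i → All Sort is × Sort i
    rankF-partial  : ∀ {f is i j} → rankF f is i → rankF f is j → i ≡ j
    rankF-nonempty : ∀ {f} → Fun f → Σ (List SortCode) λ is → ∃ (rankF f is)

open Signature public

record _≤Sig_ (L L' : Signature) : Set where
  field
    sort⊆  : ∀ {i} → Sort L i → Sort L' i
    rel⊆   : ∀ {R} → Rel L R → Rel L' R
    fun⊆   : ∀ {f} → Fun L f → Fun L' f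
    rankR⊆ : ∀ {R is} → Rel L R → rankR L R is → rankR L' R is
    rankF⊆ : ∀ {f is i} → Fun L f → rankF L f is i → rankF L' f is i

data Term : Set where
  var : Var → Term
  app : FunSym → List Term → Term

infixr 6 _∧'_
infixr 5 _∨'_
infixr 4 _⇒'_
infix 7 _≐_

data Formula : Set where
  ⊥'    : Formula
  _≐_   : Term → Term → Formula
  rel   : RelSym → List Term → Formula
  _∧'_  : Formula → Formula → Formula
  _∨'_  : Formula → Formula → Formula
  _⇒'_  : Formula → Formula → Formula
  ex    : Var → Formula → Formula
  all   : Var → Formula → Formula

data WellSortedTerm (L : Signature) : Term → SortCode → Set where
  var : ∀ {i n} → Sort L i → WellSortedTerm L (var (i , n)) i
  app : ∀ {f ts is i} → rankF L f is i →
        Pointwise (WellSortedTerm L) ts is →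
        WellSortedTerm L (app f ts) i

data WellSorted (L : Signature) : Formula → Set where
  ⊥'  : WellSorted L ⊥'
  eq  : ∀ {t u i} → WellSortedTerm L t i → WellSortedTerm L u i →
        WellSorted L (t ≐ u)
  rel : ∀ {R ts is} → rankR L R is → Pointwise (WellSortedTerm L) ts is →
        WellSorted L (rel R ts)
  and : ∀ {φ ψ} → WellSorted L φ → WellSorted L ψ → WellSorted L (φ ∧' ψ)
  or  : ∀ {φ ψ} → WellSorted L φ → WellSorted L ψ → WellSorted L (φ ∨' ψ)
  imp : ∀ {φ ψ} → WellSorted L φ → WellSorted L ψ → WellSorted L (φ ⇒' ψ)
  ex  : ∀ {i n φ} → Sort L i → WellSorted L φ → WellSorted L (ex (i , n) φ)
  all : ∀ {i n φ} → Sort L i → WellSorted L φ → WellSorted L (all (i , n) φ)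

data FreeInTerm (x : Var) : Term → Set where
  var : FreeInTerm x (var x)
  app : ∀ {f ts} → Any (FreeInTerm x) ts → FreeInTerm x (app f ts)

data FreeIn (x : Var) : Formula → Set where
  eqˡ  : ∀ {t u} → FreeInTerm x t → FreeIn x (t ≐ u)
  eqʳ  : ∀ {t u} → FreeInTerm x u → FreeIn x (t ≐ u)
  rel  : ∀ {R ts} → Any (FreeInTerm x) ts → FreeIn x (rel R ts)
  andˡ : ∀ {φ ψ} → FreeIn x φ → FreeIn x (φ ∧' ψ)
  andʳ : ∀ {φ ψ} → FreeIn x ψ → FreeIn x (φ ∧' ψ)
  orˡ  : ∀ {φ ψ} → FreeIn x φ → FreeIn x (φ ∨' ψ)
  orʳ  : ∀ {φ ψ} → FreeIn x ψ → FreeIn x (φ ∨' ψ)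
  impˡ : ∀ {φ ψ} → FreeIn x φ → FreeIn x (φ ⇒' ψ)
  impʳ : ∀ {φ ψ} → FreeIn x ψ → FreeIn x (φ ⇒' ψ)
  ex   : ∀ {y φ} → x ≢ y → FreeIn x φ → FreeIn x (ex y φ)
  all  : ∀ {y φ} → x ≢ y → FreeIn x φ → FreeIn x (all y φ)

-- Substitution of a term for the free occurrences of a variable
-- (used only when the term is free for the variable, see FreeFor)

mutual
  substT : Term → Var → Term → Term
  substT s x (var y) with y ≟v x
  ... | yes _ = s
  ... | no  _ = var y
  substT s x (app f ts) = app f (substTs s x ts)

  substTs : Term → Var → List Term → List Term
  substTs s x [] = []
  substTs s x (t ∷ ts) = substT s x t ∷ substTs s x ts

_[_/_] : Formula → Term → Var → Formula
⊥' [ s / x ] = ⊥'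
(t ≐ u) [ s / x ] = substT s x t ≐ substT s x u
rel R ts [ s / x ] = rel R (substTs s x ts)
(φ ∧' ψ) [ s / x ] = (φ [ s / x ]) ∧' (ψ [ s / x ])
(φ ∨' ψ) [ s / x ] = (φ [ s / x ]) ∨' (ψ [ s / x ])
(φ ⇒' ψ) [ s / x ] = (φ [ s / x ]) ⇒' (ψ [ s / x ])
ex y φ [ s / x ] with y ≟v x
... | yes _ = ex y φ
... | no  _ = ex y (φ [ s / x ])
all y φ [ s / x ] with y ≟v x
... | yes _ = all y φ
... | no  _ = all y (φ [ s / x ])

FreeFor : Term → Var → Formula → Set
FreeFor s x ⊥' = ⊤
FreeFor s x (t ≐ u) = ⊤
FreeFor s x (rel R ts) = ⊤
FreeFor s x (φ ∧' ψ) = FreeFor s x φ × FreeFor s x ψ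
FreeFor s x (φ ∨' ψ) = FreeFor s x φ × FreeFor s x ψ
FreeFor s x (φ ⇒' ψ) = FreeFor s x φ × FreeFor s x ψ
FreeFor s x (ex y φ) =
  y ≡ x ⊎ (¬ FreeIn x φ ⊎ (¬ FreeInTerm y s × FreeFor s x φ))
FreeFor s x (all y φ) =
  y ≡ x ⊎ (¬ FreeIn x φ ⊎ (¬ FreeInTerm y s × FreeFor s x φ))

⊤' : Formula
⊤' = ⊥' ⇒' ⊥'

⋀ : List Formula → Formula
⋀ [] = ⊤'
⋀ (φ ∷ φs) = φ ∧' ⋀ φs

∀* : List Var → Formula → Formula
∀* [] φ = φ
∀* (x ∷ xs) φ = all x (∀* xs φ)

xsFrom : ℕ → List SortCode → List Var
xsFrom k [] = []
xsFrom k (i ∷ is) = (i , 2 * k) ∷ xsFrom (suc k) is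

ysFrom : ℕ → List SortCode → List Var
ysFrom k [] = []
ysFrom k (i ∷ is) = (i , suc (2 * k)) ∷ ysFrom (suc k) is

vars : List Var → List Term
vars [] = []
vars (x ∷ xs) = var x ∷ vars xs

eqs : List Var → List Var → List Formula
eqs (x ∷ xs) (y ∷ ys) = (var x ≐ var y) ∷ eqs xs ys
eqs _ _ = []

data EqualityAxiom (L : Signature) : Formula → Set where
  eq-refl  : ∀ {i} → Sort L i →
    EqualityAxiom L (all (i , 0) (var (i , 0) ≐ var (i , 0)))
  eq-sym   : ∀ {i} → Sort L i →
    EqualityAxiom L (all (i , 0) (all (i , 1)
      ((var (i , 0) ≐ var (i , 1)) ⇒' (var (i , 1) ≐ var (i , 0)))))
  eq-trans : ∀ {i} → Sort L i →
    EqualityAxiom L (all (i , 0) (all (i , 1) (all (i , 2)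
      (((var (i , 0) ≐ var (i , 1)) ∧' (var (i , 1) ≐ var (i , 2)))
        ⇒' (var (i , 0) ≐ var (i , 2))))))
  eq-rel   : ∀ {R is} → rankR L R is →
    EqualityAxiom L (∀* (xsFrom 0 is) (∀* (ysFrom 0 is)
      (⋀ (eqs (xsFrom 0 is) (ysFrom 0 is)) ⇒'
        (rel R (vars (xsFrom 0 is)) ⇒' rel R (vars (ysFrom 0 is))))))
  eq-fun   : ∀ {f is i} → rankF L f is i →
    EqualityAxiom L (∀* (xsFrom 0 is) (∀* (ysFrom 0 is)
      (⋀ (eqs (xsFrom 0 is) (ysFrom 0 is)) ⇒'
        (app f (vars (xsFrom 0 is)) ≐ app f (vars (ysFrom 0 is))))))

-- Every formula
-- occurring in a derivation is required to be a well-sorted L-formula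
-- (each rule requires its conclusion to be well-sorted; discharged
-- assumptions are subformulas of well-sorted conclusions).

NotFreeInAll : Var → List Formula → Set
NotFreeInAll y Δ = All (λ ψ → ¬ FreeIn y ψ) Δ

data Deriv (L : Signature) : List Formula → Formula → Set where
  assum : ∀ {Δ φ} → WellSorted L φ → φ ∈ Δ → Deriv L Δ φ
  axiom : ∀ {Δ φ} → WellSorted L φ → EqualityAxiom L φ → Deriv L Δ φ
  ∧I  : ∀ {Δ φ ψ} → WellSorted L (φ ∧' ψ) →
        Deriv L Δ φ → Deriv L Δ ψ → Deriv L Δ (φ ∧' ψ)
  ∧E₁ : ∀ {Δ φ ψ} → WellSorted L φ → Deriv L Δ (φ ∧' ψ) → Deriv L Δ φ
  ∧E₂ : ∀ {Δ φ ψ} → WellSorted L ψ → Deriv L Δ (φ ∧' ψ) → Deriv L Δ ψ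
  ∨I₁ : ∀ {Δ φ ψ} → WellSorted L (φ ∨' ψ) → Deriv L Δ φ → Deriv L Δ (φ ∨' ψ)
  ∨I₂ : ∀ {Δ φ ψ} → WellSorted L (φ ∨' ψ) → Deriv L Δ ψ → Deriv L Δ (φ ∨' ψ)
  ∨E  : ∀ {Δ φ ψ χ} → WellSorted L χ →
        Deriv L Δ (φ ∨' ψ) → Deriv L (φ ∷ Δ) χ → Deriv L (ψ ∷ Δ) χ →
        Deriv L Δ χ
  ⇒I  : ∀ {Δ φ ψ} → WellSorted L (φ ⇒' ψ) →
        Deriv L (φ ∷ Δ) ψ → Deriv L Δ (φ ⇒' ψ)
  ⇒E  : ∀ {Δ φ ψ} → WellSorted L ψ →
        Deriv L Δ (φ ⇒' ψ) → Deriv L Δ φ → Deriv L Δ ψ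
  ⊥E  : ∀ {Δ φ} → WellSorted L φ → Deriv L Δ ⊥' → Deriv L Δ φ
  RAA : ∀ {Δ φ} → WellSorted L φ →
        Deriv L ((φ ⇒' ⊥') ∷ Δ) ⊥' → Deriv L Δ φ
  ∀I  : ∀ {Δ x y φ} → WellSorted L (all x φ) → sortOf y ≡ sortOf x →
        FreeFor (var y) x φ → ¬ FreeIn y (all x φ) → NotFreeInAll y Δ →
        Deriv L Δ (φ [ var y / x ]) → Deriv L Δ (all x φ)
  ∀E  : ∀ {Δ x φ t} → WellSorted L (φ [ t / x ]) →
        WellSortedTerm L t (sortOf x) → FreeFor t x φ →
        Deriv L Δ (all x φ) → Deriv L Δ (φ [ t / x ])
  ∃I  : ∀ {Δ x φ t} → WellSorted L (ex x φ) →
        WellSortedTerm L t (sortOf x) → FreeFor t x φ →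
        Deriv L Δ (φ [ t / x ]) → Deriv L Δ (ex x φ)
  ∃E  : ∀ {Δ x y φ χ} → WellSorted L χ → sortOf y ≡ sortOf x →
        FreeFor (var y) x φ → ¬ FreeIn y (ex x φ) → ¬ FreeIn y χ →
        NotFreeInAll y Δ →
        Deriv L Δ (ex x φ) → Deriv L ((φ [ var y / x ]) ∷ Δ) χ →
        Deriv L Δ χ

-- Γ ⊢^L_MSL φ  (Γ an arbitrary set of formulas, given as a predicate):
-- some derivation of φ whose open assumptions all lie in Γ.
_⊢[_]_ : (Formula → Set) → Signature → Formula → Set
Γ ⊢[ L ] φ = Σ (List Formula) λ Δ → All Γ Δ × Deriv L Δ φ

-- Only finitely many symbols of L occur in the open assumptions and the conclusion; they
-- form a subsignature L₀ ≤ L whose sorts and ranks are decidable, which is what makes the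
-- following case distinctions constructive.  An L'-derivation is then restricted to L₀:
-- a term whose sort or head symbol is not in L₀ collapses to a dummy variable whose index N
-- is used nowhere in the derivation, an equation at a foreign sort becomes ⊤', a foreign
-- atom becomes ⊥', and a quantifier over a foreign sort is dropped.  Restriction fixes
-- L₀-formulas, commutes with substitution (variables of foreign sorts never survive it),
-- and turns every rule instance and every equality axiom of L' into a derivable L₀-step.

module Submission where

open import Defs

open import Data.Bool using (if_then_else_)
open import Data.Empty using (⊥-elim)
open import Data.List using (List; []; _∷_; _++_)
import Data.List.Properties as Listₚ
open import Data.List.Membership.Propositional using (_∈_; _∉_)
import Data.List.Membership.DecPropositional as DecMembership
open import Data.List.Membership.Propositional.Properties using (∈-++⁺ˡ; ∈-++⁺ʳ)
open import Data.List.Relation.Binary.Pointwise using (Pointwise; []; _∷_)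
open import Data.List.Relation.Unary.All using (All; []; _∷_; all?)
import Data.List.Relation.Unary.All as All
import Data.List.Relation.Unary.All.Properties as Allₚ
open import Data.List.Relation.Unary.Any using (Any; here; there)
open import Data.Nat using (ℕ; suc)
import Data.Nat.Properties as ℕ
open import Data.List.Extrema ℕ.≤-totalOrder using (max; xs≤max)
open import Data.Product using (Σ; ∃; _×_; _,_; proj₁; proj₂)
import Data.Product as Product
import Data.Product.Properties as Productₚ
open import Data.Sum using (_⊎_; inj₁; inj₂)
import Data.Sum as Sum
open import Data.Unit using (tt)
open import Relation.Nullary using (¬_; Dec; does; yes; no)
open import Relation.Nullary.Decidable using (_×-dec_)
open import Relation.Binary.PropositionalEquality
  using (_≡_; _≢_; refl; sym; trans; cong; cong₂; subst; subst₂)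

≤Sig-trans : ∀ {L₁ L₂ L₃} → L₁ ≤Sig L₂ → L₂ ≤Sig L₃ → L₁ ≤Sig L₃
≤Sig-trans L₁≤L₂ L₂≤L₃ = record
  { sort⊆  = λ s → sort⊆ L₂≤L₃ (sort⊆ L₁≤L₂ s)
  ; rel⊆   = λ r → rel⊆ L₂≤L₃ (rel⊆ L₁≤L₂ r)
  ; fun⊆   = λ f → fun⊆ L₂≤L₃ (fun⊆ L₁≤L₂ f)
  ; rankR⊆ = λ r ρ → rankR⊆ L₂≤L₃ (rel⊆ L₁≤L₂ r) (rankR⊆ L₁≤L₂ r ρ)
  ; rankF⊆ = λ f ρ → rankF⊆ L₂≤L₃ (fun⊆ L₁≤L₂ f) (rankF⊆ L₁≤L₂ f ρ)
  }
  where open _≤Sig_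

module Monotone {L L' : Signature} (L≤L' : L ≤Sig L') where
  open _≤Sig_ L≤L'

  wellSortedTerm-mono : ∀ {t i} → WellSortedTerm L t i → WellSortedTerm L' t i
  wellSortedTerms-mono : ∀ {ts is} → Pointwise (WellSortedTerm L) ts is →
                         Pointwise (WellSortedTerm L') ts is
  wellSortedTerm-mono (var s) = var (sort⊆ s)
  wellSortedTerm-mono (app ρ ws) = app (rankF⊆ (rankF-fun L ρ) ρ) (wellSortedTerms-mono ws)
  wellSortedTerms-mono [] = []
  wellSortedTerms-mono (w ∷ ws) = wellSortedTerm-mono w ∷ wellSortedTerms-mono ws

  wellSorted-mono : ∀ {φ} → WellSorted L φ → WellSorted L' φ
  wellSorted-mono ⊥' = ⊥'
  wellSorted-mono (eq a b) = eq (wellSortedTerm-mono a) (wellSortedTerm-mono b)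
  wellSorted-mono (rel ρ ws) = rel (rankR⊆ (rankR-rel L ρ) ρ) (wellSortedTerms-mono ws)
  wellSorted-mono (and a b) = and (wellSorted-mono a) (wellSorted-mono b)
  wellSorted-mono (or a b) = or (wellSorted-mono a) (wellSorted-mono b)
  wellSorted-mono (imp a b) = imp (wellSorted-mono a) (wellSorted-mono b)
  wellSorted-mono (ex s w) = ex (sort⊆ s) (wellSorted-mono w)
  wellSorted-mono (all s w) = all (sort⊆ s) (wellSorted-mono w)

  equalityAxiom-mono : ∀ {φ} → EqualityAxiom L φ → EqualityAxiom L' φ
  equalityAxiom-mono (eq-refl s) = eq-refl (sort⊆ s)
  equalityAxiom-mono (eq-sym s) = eq-sym (sort⊆ s)
  equalityAxiom-mono (eq-trans s) = eq-trans (sort⊆ s)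
  equalityAxiom-mono (eq-rel ρ) = eq-rel (rankR⊆ (rankR-rel L ρ) ρ)
  equalityAxiom-mono (eq-fun ρ) = eq-fun (rankF⊆ (rankF-fun L ρ) ρ)

  deriv-mono : ∀ {Δ φ} → Deriv L Δ φ → Deriv L' Δ φ
  deriv-mono (assum w m) = assum (wellSorted-mono w) m
  deriv-mono (axiom w a) = axiom (wellSorted-mono w) (equalityAxiom-mono a)
  deriv-mono (∧I w d e) = ∧I (wellSorted-mono w) (deriv-mono d) (deriv-mono e)
  deriv-mono (∧E₁ w d) = ∧E₁ (wellSorted-mono w) (deriv-mono d)
  deriv-mono (∧E₂ w d) = ∧E₂ (wellSorted-mono w) (deriv-mono d)
  deriv-mono (∨I₁ w d) = ∨I₁ (wellSorted-mono w) (deriv-mono d)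
  deriv-mono (∨I₂ w d) = ∨I₂ (wellSorted-mono w) (deriv-mono d)
  deriv-mono (∨E w d e f) = ∨E (wellSorted-mono w) (deriv-mono d) (deriv-mono e) (deriv-mono f)
  deriv-mono (⇒I w d) = ⇒I (wellSorted-mono w) (deriv-mono d)
  deriv-mono (⇒E w d e) = ⇒E (wellSorted-mono w) (deriv-mono d) (deriv-mono e)
  deriv-mono (⊥E w d) = ⊥E (wellSorted-mono w) (deriv-mono d)
  deriv-mono (RAA w d) = RAA (wellSorted-mono w) (deriv-mono d)
  deriv-mono (∀I w e ff nf nfΔ d) = ∀I (wellSorted-mono w) e ff nf nfΔ (deriv-mono d)
  deriv-mono (∀E w wt ff d) = ∀E (wellSorted-mono w) (wellSortedTerm-mono wt) ff (deriv-mono d)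
  deriv-mono (∃I w wt ff d) = ∃I (wellSorted-mono w) (wellSortedTerm-mono wt) ff (deriv-mono d)
  deriv-mono (∃E w e ff nf nfχ nfΔ d d') =
    ∃E (wellSorted-mono w) e ff nf nfχ nfΔ (deriv-mono d) (deriv-mono d')

deriv-wellSorted : ∀ {L Δ φ} → Deriv L Δ φ → WellSorted L φ
deriv-wellSorted (assum w _) = w
deriv-wellSorted (axiom w _) = w
deriv-wellSorted (∧I w _ _) = w
deriv-wellSorted (∧E₁ w _) = w
deriv-wellSorted (∧E₂ w _) = w
deriv-wellSorted (∨I₁ w _) = w
deriv-wellSorted (∨I₂ w _) = w
deriv-wellSorted (∨E w _ _ _) = w
deriv-wellSorted (⇒I w _) = w
deriv-wellSorted (⇒E w _ _) = w
deriv-wellSorted (⊥E w _) = w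
deriv-wellSorted (RAA w _) = w
deriv-wellSorted (∀I w _ _ _ _ _) = w
deriv-wellSorted (∀E w _ _ _) = w
deriv-wellSorted (∃I w _ _ _) = w
deriv-wellSorted (∃E w _ _ _ _ _ _ _) = w

wellSortedTerm-sort : ∀ {L t i} → WellSortedTerm L t i → Sort L i
wellSortedTerm-sort (var s) = s
wellSortedTerm-sort {L} (app ρ _) = proj₂ (rankF-sorts L ρ)

wellSortedTerm-unique : ∀ {L t i j} → WellSortedTerm L t i → WellSortedTerm L t j → i ≡ j
wellSortedTerms-unique : ∀ {L ts is js} → Pointwise (WellSortedTerm L) ts is →
                         Pointwise (WellSortedTerm L) ts js → is ≡ js
wellSortedTerm-unique (var _) (var _) = refl
wellSortedTerm-unique {L} (app ρ ws) (app ρ' ws') with wellSortedTerms-unique ws ws'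
... | refl = rankF-partial L ρ ρ'
wellSortedTerms-unique [] [] = refl
wellSortedTerms-unique (w ∷ ws) (w' ∷ ws') =
  cong₂ _∷_ (wellSortedTerm-unique w w') (wellSortedTerms-unique ws ws')

substT-var-≡ : ∀ s x y → y ≡ x → substT s x (var y) ≡ s
substT-var-≡ s x y y≡x with y ≟v x
... | yes _ = refl
... | no y≢x = ⊥-elim (y≢x y≡x)

substT-var-≢ : ∀ s x y → y ≢ x → substT s x (var y) ≡ var y
substT-var-≢ s x y y≢x with y ≟v x
... | yes y≡x = ⊥-elim (y≢x y≡x)
... | no _ = refl

subst-ex-≡ : ∀ y φ s x → y ≡ x → ex y φ [ s / x ] ≡ ex y φ
subst-ex-≡ y φ s x y≡x with y ≟v x
... | yes _ = refl
... | no y≢x = ⊥-elim (y≢x y≡x)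

subst-ex-≢ : ∀ y φ s x → y ≢ x → ex y φ [ s / x ] ≡ ex y (φ [ s / x ])
subst-ex-≢ y φ s x y≢x with y ≟v x
... | yes y≡x = ⊥-elim (y≢x y≡x)
... | no _ = refl

subst-all-≡ : ∀ y φ s x → y ≡ x → all y φ [ s / x ] ≡ all y φ
subst-all-≡ y φ s x y≡x with y ≟v x
... | yes _ = refl
... | no y≢x = ⊥-elim (y≢x y≡x)

subst-all-≢ : ∀ y φ s x → y ≢ x → all y φ [ s / x ] ≡ all y (φ [ s / x ])
subst-all-≢ y φ s x y≢x with y ≟v x
... | yes y≡x = ⊥-elim (y≢x y≡x)
... | no _ = refl

module _ {L : Signature} {x : Var} {s : Term} (ws : WellSortedTerm L s (sortOf x)) where

  substT-wellSorted : ∀ {t i} → WellSortedTerm L t i → WellSortedTerm L (substT s x t) i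
  substTs-wellSorted : ∀ {ts is} → Pointwise (WellSortedTerm L) ts is →
                       Pointwise (WellSortedTerm L) (substTs s x ts) is
  substT-wellSorted {var y} (var sy) with y ≟v x
  ... | yes refl = ws
  ... | no _ = var sy
  substT-wellSorted (app ρ wts) = app ρ (substTs-wellSorted wts)
  substTs-wellSorted [] = []
  substTs-wellSorted (w ∷ wts) = substT-wellSorted w ∷ substTs-wellSorted wts

  subst-wellSorted : ∀ {φ} → WellSorted L φ → WellSorted L (φ [ s / x ])
  subst-wellSorted ⊥' = ⊥'
  subst-wellSorted (eq a b) = eq (substT-wellSorted a) (substT-wellSorted b)
  subst-wellSorted (rel ρ wts) = rel ρ (substTs-wellSorted wts)
  subst-wellSorted (and a b) = and (subst-wellSorted a) (subst-wellSorted b)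
  subst-wellSorted (or a b) = or (subst-wellSorted a) (subst-wellSorted b)
  subst-wellSorted (imp a b) = imp (subst-wellSorted a) (subst-wellSorted b)
  subst-wellSorted (ex {i} {n} si w) with (i , n) ≟v x
  ... | yes _ = ex si w
  ... | no _ = ex si (subst-wellSorted w)
  subst-wellSorted (all {i} {n} si w) with (i , n) ≟v x
  ... | yes _ = all si w
  ... | no _ = all si (subst-wellSorted w)

substT-notFree : ∀ s x t → ¬ FreeInTerm x t → substT s x t ≡ t
substTs-notFree : ∀ s x ts → ¬ Any (FreeInTerm x) ts → substTs s x ts ≡ ts
substT-notFree s x (var y) x∉t = substT-var-≢ s x y λ { refl → x∉t var }
substT-notFree s x (app f ts) x∉t = cong (app f) (substTs-notFree s x ts (λ a → x∉t (app a)))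
substTs-notFree s x [] _ = refl
substTs-notFree s x (t ∷ ts) x∉ts =
  cong₂ _∷_ (substT-notFree s x t (λ a → x∉ts (here a)))
            (substTs-notFree s x ts (λ a → x∉ts (there a)))

subst-notFree : ∀ s x φ → ¬ FreeIn x φ → φ [ s / x ] ≡ φ
subst-notFree s x ⊥' _ = refl
subst-notFree s x (t ≐ u) x∉φ =
  cong₂ _≐_ (substT-notFree s x t (λ a → x∉φ (eqˡ a))) (substT-notFree s x u (λ a → x∉φ (eqʳ a)))
subst-notFree s x (rel R ts) x∉φ = cong (rel R) (substTs-notFree s x ts (λ a → x∉φ (rel a)))
subst-notFree s x (φ ∧' ψ) x∉ =
  cong₂ _∧'_ (subst-notFree s x φ (λ a → x∉ (andˡ a))) (subst-notFree s x ψ (λ a → x∉ (andʳ a)))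
subst-notFree s x (φ ∨' ψ) x∉ =
  cong₂ _∨'_ (subst-notFree s x φ (λ a → x∉ (orˡ a))) (subst-notFree s x ψ (λ a → x∉ (orʳ a)))
subst-notFree s x (φ ⇒' ψ) x∉ =
  cong₂ _⇒'_ (subst-notFree s x φ (λ a → x∉ (impˡ a))) (subst-notFree s x ψ (λ a → x∉ (impʳ a)))
subst-notFree s x (ex y φ) x∉ with y ≟v x
... | yes _ = refl
... | no y≢x = cong (ex y) (subst-notFree s x φ (λ a → x∉ (ex (λ x≡y → y≢x (sym x≡y)) a)))
subst-notFree s x (all y φ) x∉ with y ≟v x
... | yes _ = refl
... | no y≢x = cong (all y) (subst-notFree s x φ (λ a → x∉ (all (λ x≡y → y≢x (sym x≡y)) a)))

freeFor-notFree : ∀ s x φ → ¬ FreeIn x φ → FreeFor s x φ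
freeFor-notFree s x ⊥' _ = tt
freeFor-notFree s x (t ≐ u) _ = tt
freeFor-notFree s x (rel R ts) _ = tt
freeFor-notFree s x (φ ∧' ψ) x∉ =
  freeFor-notFree s x φ (λ a → x∉ (andˡ a)) , freeFor-notFree s x ψ (λ a → x∉ (andʳ a))
freeFor-notFree s x (φ ∨' ψ) x∉ =
  freeFor-notFree s x φ (λ a → x∉ (orˡ a)) , freeFor-notFree s x ψ (λ a → x∉ (orʳ a))
freeFor-notFree s x (φ ⇒' ψ) x∉ =
  freeFor-notFree s x φ (λ a → x∉ (impˡ a)) , freeFor-notFree s x ψ (λ a → x∉ (impʳ a))
freeFor-notFree s x (ex y φ) x∉ with y ≟v x
... | yes y≡x = inj₁ y≡x
... | no y≢x = inj₂ (inj₁ (λ a → x∉ (ex (λ x≡y → y≢x (sym x≡y)) a)))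
freeFor-notFree s x (all y φ) x∉ with y ≟v x
... | yes y≡x = inj₁ y≡x
... | no y≢x = inj₂ (inj₁ (λ a → x∉ (all (λ x≡y → y≢x (sym x≡y)) a)))

∉-++⁻ˡ : ∀ {n : ℕ} {ms ks} → n ∉ ms ++ ks → n ∉ ms
∉-++⁻ˡ n∉ n∈ = n∉ (∈-++⁺ˡ n∈)

∉-++⁻ʳ : ∀ {n : ℕ} ms {ks} → n ∉ ms ++ ks → n ∉ ks
∉-++⁻ʳ ms n∉ n∈ = n∉ (∈-++⁺ʳ ms n∈)

∉-∷⁻ʰ : ∀ {n m : ℕ} {ms} → n ∉ m ∷ ms → m ≢ n
∉-∷⁻ʰ n∉ m≡n = n∉ (here (sym m≡n))

∉-∷⁻ᵗ : ∀ {n m : ℕ} {ms} → n ∉ m ∷ ms → n ∉ ms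
∉-∷⁻ᵗ n∉ n∈ = n∉ (there n∈)

fresh : (ns : List ℕ) → ∃ λ n → n ∉ ns
fresh ns = suc (max 0 ns) , λ n∈ns → ℕ.<-irrefl refl (All.lookup (xs≤max 0 ns) n∈ns)

indicesT : Term → List ℕ
indicesTs : List Term → List ℕ
indicesT (var (_ , n)) = n ∷ []
indicesT (app _ ts) = indicesTs ts
indicesTs [] = []
indicesTs (t ∷ ts) = indicesT t ++ indicesTs ts

indices : Formula → List ℕ
indices ⊥' = []
indices (t ≐ u) = indicesT t ++ indicesT u
indices (rel _ ts) = indicesTs ts
indices (φ ∧' ψ) = indices φ ++ indices ψ
indices (φ ∨' ψ) = indices φ ++ indices ψ
indices (φ ⇒' ψ) = indices φ ++ indices ψ
indices (ex (_ , n) φ) = n ∷ indices φ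
indices (all (_ , n) φ) = n ∷ indices φ

indicesCtx : List Formula → List ℕ
indicesCtx [] = []
indicesCtx (φ ∷ Δ) = indices φ ++ indicesCtx Δ

freeInTerm⇒index∈ : ∀ {i n} t → FreeInTerm (i , n) t → n ∈ indicesT t
freeInTerms⇒index∈ : ∀ {i n} ts → Any (FreeInTerm (i , n)) ts → n ∈ indicesTs ts
freeInTerm⇒index∈ (var _) var = here refl
freeInTerm⇒index∈ (app f ts) (app a) = freeInTerms⇒index∈ ts a
freeInTerms⇒index∈ (t ∷ ts) (here a) = ∈-++⁺ˡ (freeInTerm⇒index∈ t a)
freeInTerms⇒index∈ (t ∷ ts) (there a) = ∈-++⁺ʳ (indicesT t) (freeInTerms⇒index∈ ts a)

freeIn⇒index∈ : ∀ {i n} φ → FreeIn (i , n) φ → n ∈ indices φ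
freeIn⇒index∈ (t ≐ u) (eqˡ a) = ∈-++⁺ˡ (freeInTerm⇒index∈ t a)
freeIn⇒index∈ (t ≐ u) (eqʳ a) = ∈-++⁺ʳ (indicesT t) (freeInTerm⇒index∈ u a)
freeIn⇒index∈ (rel R ts) (rel a) = freeInTerms⇒index∈ ts a
freeIn⇒index∈ (φ ∧' ψ) (andˡ a) = ∈-++⁺ˡ (freeIn⇒index∈ φ a)
freeIn⇒index∈ (φ ∧' ψ) (andʳ a) = ∈-++⁺ʳ (indices φ) (freeIn⇒index∈ ψ a)
freeIn⇒index∈ (φ ∨' ψ) (orˡ a) = ∈-++⁺ˡ (freeIn⇒index∈ φ a)
freeIn⇒index∈ (φ ∨' ψ) (orʳ a) = ∈-++⁺ʳ (indices φ) (freeIn⇒index∈ ψ a)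
freeIn⇒index∈ (φ ⇒' ψ) (impˡ a) = ∈-++⁺ˡ (freeIn⇒index∈ φ a)
freeIn⇒index∈ (φ ⇒' ψ) (impʳ a) = ∈-++⁺ʳ (indices φ) (freeIn⇒index∈ ψ a)
freeIn⇒index∈ (ex y φ) (ex _ a) = there (freeIn⇒index∈ φ a)
freeIn⇒index∈ (all y φ) (all _ a) = there (freeIn⇒index∈ φ a)

derivIndices : ∀ {L Δ φ} → Deriv L Δ φ → List ℕ
derivIndices (assum _ _) = []
derivIndices (axiom _ _) = []
derivIndices (∧I _ d e) = derivIndices d ++ derivIndices e
derivIndices (∧E₁ _ d) = derivIndices d
derivIndices (∧E₂ _ d) = derivIndices d
derivIndices (∨I₁ _ d) = derivIndices d
derivIndices (∨I₂ _ d) = derivIndices d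
derivIndices (∨E _ d e f) = derivIndices d ++ derivIndices e ++ derivIndices f
derivIndices (⇒I _ d) = derivIndices d
derivIndices (⇒E _ d e) = derivIndices d ++ derivIndices e
derivIndices (⊥E _ d) = derivIndices d
derivIndices (RAA _ d) = derivIndices d
derivIndices (∀I {x = _ , n} {_ , m} {φ} _ _ _ _ _ d) = n ∷ m ∷ indices φ ++ derivIndices d
derivIndices (∀E {x = _ , n} {φ} _ _ _ d) = n ∷ indices φ ++ derivIndices d
derivIndices (∃I {x = _ , n} {φ} _ _ _ d) = n ∷ indices φ ++ derivIndices d
derivIndices (∃E {x = _ , n} {_ , m} {φ} _ _ _ _ _ _ d e) =
  n ∷ m ∷ indices φ ++ derivIndices d ++ derivIndices e

notFreeInAll-fresh : ∀ {i n} Δ → n ∉ indicesCtx Δ → NotFreeInAll (i , n) Δ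
notFreeInAll-fresh [] _ = []
notFreeInAll-fresh (φ ∷ Δ) n∉ =
  (λ a → n∉ (∈-++⁺ˡ (freeIn⇒index∈ φ a))) ∷ notFreeInAll-fresh Δ (∉-++⁻ʳ (indices φ) n∉)

freeFor-fresh : ∀ {i n} x φ → n ∉ indices φ → FreeFor (var (i , n)) x φ
freeFor-fresh x ⊥' _ = tt
freeFor-fresh x (t ≐ u) _ = tt
freeFor-fresh x (rel R ts) _ = tt
freeFor-fresh x (φ ∧' ψ) n∉ =
  freeFor-fresh x φ (∉-++⁻ˡ n∉) , freeFor-fresh x ψ (∉-++⁻ʳ (indices φ) n∉)
freeFor-fresh x (φ ∨' ψ) n∉ =
  freeFor-fresh x φ (∉-++⁻ˡ n∉) , freeFor-fresh x ψ (∉-++⁻ʳ (indices φ) n∉)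
freeFor-fresh x (φ ⇒' ψ) n∉ =
  freeFor-fresh x φ (∉-++⁻ˡ n∉) , freeFor-fresh x ψ (∉-++⁻ʳ (indices φ) n∉)
freeFor-fresh x (ex y φ) n∉ =
  inj₂ (inj₂ ((λ { var → n∉ (here refl) }) , freeFor-fresh x φ (∉-∷⁻ᵗ n∉)))
freeFor-fresh x (all y φ) n∉ =
  inj₂ (inj₂ ((λ { var → n∉ (here refl) }) , freeFor-fresh x φ (∉-∷⁻ᵗ n∉)))

⊤'-intro : ∀ {L Δ} → Deriv L Δ ⊤'
⊤'-intro = ⇒I (imp ⊥' ⊥') (assum ⊥' (here refl))

⇒⊤'-intro : ∀ {L Δ φ} → WellSorted L φ → Deriv L Δ (φ ⇒' ⊤')
⇒⊤'-intro w = ⇒I (imp w (imp ⊥' ⊥')) ⊤'-intro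

≐-refl-intro : ∀ {L Δ t i} → WellSortedTerm L t i → Deriv L Δ (t ≐ t)
≐-refl-intro {L} {Δ} {t} {i} wt =
  subst (Deriv L Δ) instance≡
    (∀E (subst (WellSorted L) (sym instance≡) (eq wt wt)) wt tt
        (axiom (all s (eq (var s) (var s))) (eq-refl s)))
  where
  s = wellSortedTerm-sort wt
  instance≡ : (var (i , 0) ≐ var (i , 0)) [ t / (i , 0) ] ≡ (t ≐ t)
  instance≡ = cong₂ _≐_ (substT-var-≡ t _ _ refl) (substT-var-≡ t _ _ refl)

-- The shapes into which restriction turns the equality axioms of foreign symbols.  Indexed by
-- quantifier depth, since their derivations recurse on instances rather than on subterms.
data Trivial (L : Signature) : ℕ → Formula → Set where
  ⇒⊤'     : ∀ {φ} → Trivial L 0 (φ ⇒' ⊤')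
  ⇒≐-refl : ∀ {φ t i} → WellSortedTerm L t i → Trivial L 0 (φ ⇒' (t ≐ t))
  all     : ∀ {d x χ} → Trivial L d χ → Trivial L (suc d) (all x χ)

trivial-subst : ∀ {L s x d φ} → WellSortedTerm L s (sortOf x) →
                Trivial L d φ → Trivial L d (φ [ s / x ])
trivial-subst ws ⇒⊤' = ⇒⊤'
trivial-subst ws (⇒≐-refl wt) = ⇒≐-refl (substT-wellSorted ws wt)
trivial-subst {L} {s} {x} ws (all {d} {y} {χ} p) with y ≟v x
... | yes _ = all p
... | no _ = all (trivial-subst ws p)

trivial-deriv : ∀ {L d φ} → Trivial L d φ → WellSorted L φ → ∀ Δ → Deriv L Δ φ
trivial-deriv ⇒⊤' (imp w _) Δ = ⇒⊤'-intro w
trivial-deriv (⇒≐-refl wt) w Δ = ⇒I w (≐-refl-intro wt)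
trivial-deriv {L} (all {x = i , k} {χ} p) (all s w) Δ =
  ∀I (all s w) refl (freeFor-fresh (i , k) χ (∉-∷⁻ᵗ m∉φ))
     (λ a → m∉φ (freeIn⇒index∈ (all (i , k) χ) a))
     (notFreeInAll-fresh Δ (∉-++⁻ʳ (indices (all (i , k) χ)) m∉))
     (trivial-deriv (trivial-subst (var s) p) (subst-wellSorted (var s) w) Δ)
  where
  m = proj₁ (fresh (indices (all (i , k) χ) ++ indicesCtx Δ))
  m∉ = proj₂ (fresh (indices (all (i , k) χ) ++ indicesCtx Δ))
  m∉φ = ∉-++⁻ˡ m∉

HasSorts : List Var → List SortCode → Set
HasSorts = Pointwise (λ x i → sortOf x ≡ i)

xsFrom-sorts : ∀ k is → HasSorts (xsFrom k is) is
xsFrom-sorts k [] = []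
xsFrom-sorts k (i ∷ is) = refl ∷ xsFrom-sorts (suc k) is

ysFrom-sorts : ∀ k is → HasSorts (ysFrom k is) is
ysFrom-sorts k [] = []
ysFrom-sorts k (i ∷ is) = refl ∷ ysFrom-sorts (suc k) is

vars-wellSorted : ∀ {L xs is} → HasSorts xs is → All (Sort L) is →
                  Pointwise (WellSortedTerm L) (vars xs) is
vars-wellSorted [] [] = []
vars-wellSorted (refl ∷ h) (s ∷ ss) = var s ∷ vars-wellSorted h ss

vars-sorts : ∀ {L xs is js} → HasSorts xs is → Pointwise (WellSortedTerm L) (vars xs) js → js ≡ is
vars-sorts [] [] = refl
vars-sorts (refl ∷ h) (var _ ∷ ws) = cong (_ ∷_) (vars-sorts h ws)

∀*-wellSorted : ∀ {L xs is χ} → HasSorts xs is → All (Sort L) is →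
                WellSorted L χ → WellSorted L (∀* xs χ)
∀*-wellSorted [] [] w = w
∀*-wellSorted (refl ∷ h) (s ∷ ss) w = all s (∀*-wellSorted h ss w)

eqs-wellSorted : ∀ {L xs ys is} → HasSorts xs is → HasSorts ys is → All (Sort L) is →
                 WellSorted L (⋀ (eqs xs ys))
eqs-wellSorted [] [] [] = imp ⊥' ⊥'
eqs-wellSorted (refl ∷ hx) (refl ∷ hy) (s ∷ ss) = and (eq (var s) (var s)) (eqs-wellSorted hx hy ss)

equalityAxiom-wellSorted : ∀ {L φ} → EqualityAxiom L φ → WellSorted L φ
equalityAxiom-wellSorted (eq-refl s) = all s (eq (var s) (var s))
equalityAxiom-wellSorted (eq-sym s) = all s (all s (imp (eq (var s) (var s)) (eq (var s) (var s))))
equalityAxiom-wellSorted (eq-trans s) =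
  all s (all s (all s (imp (and (eq (var s) (var s)) (eq (var s) (var s))) (eq (var s) (var s)))))
equalityAxiom-wellSorted {L} (eq-rel {is = is} ρ) =
  ∀*-wellSorted hx ss (∀*-wellSorted hy ss
    (imp (eqs-wellSorted hx hy ss) (imp (rel ρ (vars-wellSorted hx ss)) (rel ρ (vars-wellSorted hy ss)))))
  where
  ss = rankR-sorts L ρ
  hx = xsFrom-sorts 0 is
  hy = ysFrom-sorts 0 is
equalityAxiom-wellSorted {L} (eq-fun {is = is} ρ) =
  ∀*-wellSorted hx ss (∀*-wellSorted hy ss
    (imp (eqs-wellSorted hx hy ss) (eq (app ρ (vars-wellSorted hx ss)) (app ρ (vars-wellSorted hy ss)))))
  where
  ss = proj₁ (rankF-sorts L ρ)
  hx = xsFrom-sorts 0 is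
  hy = ysFrom-sorts 0 is

record DecidableSignature (L : Signature) : Set where
  field
    sort?  : ∀ i → Dec (Sort L i)
    rankR? : ∀ R is → Dec (rankR L R is)
    rankF? : ∀ f is i → Dec (rankF L f is i)

record Fragment (L : Signature) : Set where
  constructor fragment
  field
    sorts       : List SortCode
    rels        : List (RelSym × List SortCode)
    funs        : List (FunSym × List SortCode × SortCode)
    sorts-valid : All (Sort L) sorts
    rels-valid  : All (λ (R , is) → rankR L R is) rels
    funs-valid  : All (λ (f , is , i) → rankF L f is i) funs

open Fragment

module _ {L : Signature} where

  infixr 6 _∪_
  infix 4 _⊆_

  ∅ : Fragment L
  ∅ = fragment [] [] [] [] [] []

  _∪_ : Fragment L → Fragment L → Fragment L
  c ∪ d = fragment (sorts c ++ sorts d) (rels c ++ rels d) (funs c ++ funs d)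
    (Allₚ.++⁺ (sorts-valid c) (sorts-valid d)) (Allₚ.++⁺ (rels-valid c) (rels-valid d))
    (Allₚ.++⁺ (funs-valid c) (funs-valid d))

  record _⊆_ (c d : Fragment L) : Set where
    field
      sorts⊆ : ∀ {i} → i ∈ sorts c → i ∈ sorts d
      rels⊆  : ∀ {r} → r ∈ rels c → r ∈ rels d
      funs⊆  : ∀ {f} → f ∈ funs c → f ∈ funs d

  open _⊆_

  ⊆-refl : ∀ {c} → c ⊆ c
  ⊆-refl = record { sorts⊆ = λ m → m ; rels⊆ = λ m → m ; funs⊆ = λ m → m }

  ∪-⊆ˡ : ∀ c {c' d} → c ∪ c' ⊆ d → c ⊆ d
  ∪-⊆ˡ c h = record
    { sorts⊆ = λ m → sorts⊆ h (∈-++⁺ˡ m)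
    ; rels⊆ = λ m → rels⊆ h (∈-++⁺ˡ m)
    ; funs⊆ = λ m → funs⊆ h (∈-++⁺ˡ m) }

  ∪-⊆ʳ : ∀ c {c' d} → c ∪ c' ⊆ d → c' ⊆ d
  ∪-⊆ʳ c h = record
    { sorts⊆ = λ m → sorts⊆ h (∈-++⁺ʳ (sorts c) m)
    ; rels⊆ = λ m → rels⊆ h (∈-++⁺ʳ (rels c) m)
    ; funs⊆ = λ m → funs⊆ h (∈-++⁺ʳ (funs c) m) }

  sortFragment : ∀ {i} → Sort L i → Fragment L
  sortFragment {i} s = fragment (i ∷ []) [] [] (s ∷ []) [] []

  relFragment : ∀ {R is} → rankR L R is → Fragment L
  relFragment {R} {is} ρ = fragment [] ((R , is) ∷ []) [] [] (ρ ∷ []) []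

  funFragment : ∀ {f is i} → rankF L f is i → Fragment L
  funFragment {f} {is} {i} ρ =
    fragment (i ∷ []) [] ((f , is , i) ∷ []) (proj₂ (rankF-sorts L ρ) ∷ []) [] (ρ ∷ [])

  termFragment : ∀ {t i} → WellSortedTerm L t i → Fragment L
  termsFragment : ∀ {ts is} → Pointwise (WellSortedTerm L) ts is → Fragment L
  termFragment (var s) = sortFragment s
  termFragment (app ρ ws) = funFragment ρ ∪ termsFragment ws
  termsFragment [] = ∅
  termsFragment (w ∷ ws) = termFragment w ∪ termsFragment ws

  formulaFragment : ∀ {φ} → WellSorted L φ → Fragment L
  formulaFragment ⊥' = ∅
  formulaFragment (eq a b) = termFragment a ∪ termFragment b
  formulaFragment (rel ρ ws) = relFragment ρ ∪ termsFragment ws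
  formulaFragment (and a b) = formulaFragment a ∪ formulaFragment b
  formulaFragment (or a b) = formulaFragment a ∪ formulaFragment b
  formulaFragment (imp a b) = formulaFragment a ∪ formulaFragment b
  formulaFragment (ex s w) = sortFragment s ∪ formulaFragment w
  formulaFragment (all s w) = sortFragment s ∪ formulaFragment w

  ctxFragment : ∀ {Δ} → All (WellSorted L) Δ → Fragment L
  ctxFragment [] = ∅
  ctxFragment (w ∷ ws) = formulaFragment w ∪ ctxFragment ws

  module _ (c : Fragment L) (nonempty : ∃ (_∈ sorts c)) where

    fragmentRankR : RelSym → List SortCode → Set
    fragmentRankR R is = (R , is) ∈ rels c × All (_∈ sorts c) is

    fragmentRankF : FunSym → List SortCode → SortCode → Set
    fragmentRankF f is i = (f , is , i) ∈ funs c × All (_∈ sorts c) is × i ∈ sorts c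

    fragmentSig : Signature
    fragmentSig = record
      { Sort = _∈ sorts c
      ; Rel = λ R → ∃ (fragmentRankR R)
      ; Fun = λ f → Σ (List SortCode) λ is → ∃ (fragmentRankF f is)
      ; rankR = fragmentRankR
      ; rankF = fragmentRankF
      ; sort-nonempty = nonempty
      ; rankR-rel = λ ρ → _ , ρ
      ; rankR-arity = λ (m , _) → rankR-arity L (All.lookup (rels-valid c) m)
      ; rankR-sorts = proj₂
      ; rankR-nonempty = λ r → r
      ; rankF-fun = λ ρ → _ , _ , ρ
      ; rankF-arity = λ (m , _) → rankF-arity L (All.lookup (funs-valid c) m)
      ; rankF-sorts = proj₂
      ; rankF-partial = λ (m , _) (m' , _) →
          rankF-partial L (All.lookup (funs-valid c) m) (All.lookup (funs-valid c) m')
      ; rankF-nonempty = λ f → f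
      }

    fragmentSig≤ : fragmentSig ≤Sig L
    fragmentSig≤ = record
      { sort⊆ = All.lookup (sorts-valid c)
      ; rel⊆ = λ (_ , m , _) → rankR-rel L (All.lookup (rels-valid c) m)
      ; fun⊆ = λ (_ , _ , m , _) → rankF-fun L (All.lookup (funs-valid c) m)
      ; rankR⊆ = λ _ (m , _) → All.lookup (rels-valid c) m
      ; rankF⊆ = λ _ (m , _) → All.lookup (funs-valid c) m
      }

    fragmentSig-decidable : DecidableSignature fragmentSig
    fragmentSig-decidable = record
      { sort? = sort?
      ; rankR? = λ R is → (R , is) ∈rel? rels c ×-dec all? sort? is
      ; rankF? = λ f is i → (f , is , i) ∈fun? funs c ×-dec (all? sort? is ×-dec sort? i)
      }
      where
      open DecMembership ℕ._≟_ using () renaming (_∈?_ to _∈sort?_)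
      open DecMembership (Productₚ.≡-dec (Productₚ.≡-dec ℕ._≟_ ℕ._≟_) (Listₚ.≡-dec ℕ._≟_))
        using () renaming (_∈?_ to _∈rel?_)
      open DecMembership (Productₚ.≡-dec (Productₚ.≡-dec ℕ._≟_ ℕ._≟_)
                                         (Productₚ.≡-dec (Listₚ.≡-dec ℕ._≟_) ℕ._≟_))
        using () renaming (_∈?_ to _∈fun?_)
      sort? : ∀ i → Dec (i ∈ sorts c)
      sort? i = i ∈sort? sorts c

    termSort∈ : ∀ {t i} (w : WellSortedTerm L t i) → termFragment w ⊆ c → i ∈ sorts c
    termSort∈ (var s) h = sorts⊆ h (here refl)
    termSort∈ (app ρ ws) h = sorts⊆ h (here refl)

    termsSorts∈ : ∀ {ts is} (ws : Pointwise (WellSortedTerm L) ts is) → termsFragment ws ⊆ c →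
                  All (_∈ sorts c) is
    termsSorts∈ [] h = []
    termsSorts∈ (w ∷ ws) h =
      termSort∈ w (∪-⊆ˡ (termFragment w) h) ∷ termsSorts∈ ws (∪-⊆ʳ (termFragment w) h)

    wellSortedTerm-fragment : ∀ {t i} (w : WellSortedTerm L t i) → termFragment w ⊆ c →
                              WellSortedTerm fragmentSig t i
    wellSortedTerms-fragment : ∀ {ts is} (ws : Pointwise (WellSortedTerm L) ts is) →
                               termsFragment ws ⊆ c → Pointwise (WellSortedTerm fragmentSig) ts is
    wellSortedTerm-fragment (var s) h = var (sorts⊆ h (here refl))
    wellSortedTerm-fragment (app ρ ws) h =
      app (funs⊆ h (here refl) , termsSorts∈ ws hws , sorts⊆ h (here refl)) (wellSortedTerms-fragment ws hws)
      where hws = ∪-⊆ʳ (funFragment ρ) h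
    wellSortedTerms-fragment [] h = []
    wellSortedTerms-fragment (w ∷ ws) h =
      wellSortedTerm-fragment w (∪-⊆ˡ (termFragment w) h) ∷
      wellSortedTerms-fragment ws (∪-⊆ʳ (termFragment w) h)

    wellSorted-fragment : ∀ {φ} (w : WellSorted L φ) → formulaFragment w ⊆ c → WellSorted fragmentSig φ
    wellSorted-fragment ⊥' h = ⊥'
    wellSorted-fragment (eq a b) h =
      eq (wellSortedTerm-fragment a (∪-⊆ˡ (termFragment a) h))
         (wellSortedTerm-fragment b (∪-⊆ʳ (termFragment a) h))
    wellSorted-fragment (rel ρ ws) h =
      rel (rels⊆ h (here refl) , termsSorts∈ ws hws) (wellSortedTerms-fragment ws hws)
      where hws = ∪-⊆ʳ (relFragment ρ) h
    wellSorted-fragment (and a b) h =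
      and (wellSorted-fragment a (∪-⊆ˡ (formulaFragment a) h))
          (wellSorted-fragment b (∪-⊆ʳ (formulaFragment a) h))
    wellSorted-fragment (or a b) h =
      or (wellSorted-fragment a (∪-⊆ˡ (formulaFragment a) h))
         (wellSorted-fragment b (∪-⊆ʳ (formulaFragment a) h))
    wellSorted-fragment (imp a b) h =
      imp (wellSorted-fragment a (∪-⊆ˡ (formulaFragment a) h))
          (wellSorted-fragment b (∪-⊆ʳ (formulaFragment a) h))
    wellSorted-fragment (ex s w) h =
      ex (sorts⊆ h (here refl)) (wellSorted-fragment w (∪-⊆ʳ (sortFragment s) h))
    wellSorted-fragment (all s w) h =
      all (sorts⊆ h (here refl)) (wellSorted-fragment w (∪-⊆ʳ (sortFragment s) h))

    ctx-wellSorted-fragment : ∀ {Δ} (ws : All (WellSorted L) Δ) → ctxFragment ws ⊆ c →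
                              All (WellSorted fragmentSig) Δ
    ctx-wellSorted-fragment [] h = []
    ctx-wellSorted-fragment (w ∷ ws) h =
      wellSorted-fragment w (∪-⊆ˡ (formulaFragment w) h) ∷
      ctx-wellSorted-fragment ws (∪-⊆ʳ (formulaFragment w) h)

module Restriction {L₀ L' : Signature} (L₀≤L' : L₀ ≤Sig L') (dec : DecidableSignature L₀)
                   (N : ℕ) where
  open DecidableSignature dec
  open Monotone L₀≤L'

  private
    WST' = WellSortedTerm L'
    WS' = WellSorted L'

  dummy : SortCode → Term
  dummy i = var (i , N)

  restrictTerm : ∀ {t i} → WST' t i → Term
  restrictTerms : ∀ {ts is} → Pointwise WST' ts is → List Term
  restrictTerm (var {i} {n} _) = if does (sort? i) then var (i , n) else dummy i
  restrictTerm (app {f} {is = is} {i} _ ws) = if does (rankF? f is i) then app f (restrictTerms ws) else dummy i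
  restrictTerms [] = []
  restrictTerms (w ∷ ws) = restrictTerm w ∷ restrictTerms ws

  restrict : ∀ {φ} → WS' φ → Formula
  restrict ⊥' = ⊥'
  restrict (eq {i = i} a b) = if does (sort? i) then restrictTerm a ≐ restrictTerm b else ⊤'
  restrict (rel {R} {is = is} _ ws) = if does (rankR? R is) then rel R (restrictTerms ws) else ⊥'
  restrict (and a b) = restrict a ∧' restrict b
  restrict (or a b) = restrict a ∨' restrict b
  restrict (imp a b) = restrict a ⇒' restrict b
  restrict (ex {i} {n} _ w) = if does (sort? i) then ex (i , n) (restrict w) else restrict w
  restrict (all {i} {n} _ w) = if does (sort? i) then all (i , n) (restrict w) else restrict w

  restrictCtx : ∀ {Δ} → All WS' Δ → List Formula
  restrictCtx [] = []
  restrictCtx (w ∷ ws) = restrict w ∷ restrictCtx ws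

  restrictTerm-wellSorted : ∀ {t i} (w : WST' t i) → Sort L₀ i → WellSortedTerm L₀ (restrictTerm w) i
  restrictTerms-wellSorted : ∀ {ts is} (ws : Pointwise WST' ts is) → All (Sort L₀) is →
                             Pointwise (WellSortedTerm L₀) (restrictTerms ws) is
  restrictTerm-wellSorted (var {i} _) s with sort? i
  ... | yes _ = var s
  ... | no ¬s = ⊥-elim (¬s s)
  restrictTerm-wellSorted (app {f} {is = is} {i} _ ws) s with rankF? f is i
  ... | yes ρ = app ρ (restrictTerms-wellSorted ws (proj₁ (rankF-sorts L₀ ρ)))
  ... | no _ = var s
  restrictTerms-wellSorted [] [] = []
  restrictTerms-wellSorted (w ∷ ws) (s ∷ ss) = restrictTerm-wellSorted w s ∷ restrictTerms-wellSorted ws ss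

  restrict-wellSorted : ∀ {φ} (w : WS' φ) → WellSorted L₀ (restrict w)
  restrict-wellSorted ⊥' = ⊥'
  restrict-wellSorted (eq {i = i} a b) with sort? i
  ... | yes s = eq (restrictTerm-wellSorted a s) (restrictTerm-wellSorted b s)
  ... | no _ = imp ⊥' ⊥'
  restrict-wellSorted (rel {R} {is = is} _ ws) with rankR? R is
  ... | yes ρ = rel ρ (restrictTerms-wellSorted ws (rankR-sorts L₀ ρ))
  ... | no _ = ⊥'
  restrict-wellSorted (and a b) = and (restrict-wellSorted a) (restrict-wellSorted b)
  restrict-wellSorted (or a b) = or (restrict-wellSorted a) (restrict-wellSorted b)
  restrict-wellSorted (imp a b) = imp (restrict-wellSorted a) (restrict-wellSorted b)
  restrict-wellSorted (ex {i} _ w) with sort? i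
  ... | yes s = ex s (restrict-wellSorted w)
  ... | no _ = restrict-wellSorted w
  restrict-wellSorted (all {i} _ w) with sort? i
  ... | yes s = all s (restrict-wellSorted w)
  ... | no _ = restrict-wellSorted w

  restrictTerm-unique : ∀ {t i j} (w : WST' t i) (w' : WST' t j) → restrictTerm w ≡ restrictTerm w'
  restrictTerms-unique : ∀ {ts is js} (ws : Pointwise WST' ts is) (ws' : Pointwise WST' ts js) →
                         restrictTerms ws ≡ restrictTerms ws'
  restrictTerm-unique (var _) (var _) = refl
  restrictTerm-unique (app ρ ws) (app ρ' ws') with wellSortedTerms-unique ws ws'
  ... | refl with rankF-partial L' ρ ρ'
  ... | refl rewrite restrictTerms-unique ws ws' = refl
  restrictTerms-unique [] [] = refl
  restrictTerms-unique (w ∷ ws) (w' ∷ ws') =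
    cong₂ _∷_ (restrictTerm-unique w w') (restrictTerms-unique ws ws')

  restrict-unique : ∀ {φ} (w w' : WS' φ) → restrict w ≡ restrict w'
  restrict-unique ⊥' ⊥' = refl
  restrict-unique (eq a b) (eq a' b') with wellSortedTerm-unique a a'
  ... | refl rewrite restrictTerm-unique a a' | restrictTerm-unique b b' = refl
  restrict-unique (rel _ ws) (rel _ ws') with wellSortedTerms-unique ws ws'
  ... | refl rewrite restrictTerms-unique ws ws' = refl
  restrict-unique (and a b) (and a' b') = cong₂ _∧'_ (restrict-unique a a') (restrict-unique b b')
  restrict-unique (or a b) (or a' b') = cong₂ _∨'_ (restrict-unique a a') (restrict-unique b b')
  restrict-unique (imp a b) (imp a' b') = cong₂ _⇒'_ (restrict-unique a a') (restrict-unique b b')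
  restrict-unique (ex _ w) (ex _ w') rewrite restrict-unique w w' = refl
  restrict-unique (all _ w) (all _ w') rewrite restrict-unique w w' = refl

  restrict-∈ : ∀ {Δ φ} → φ ∈ Δ → (ws : All WS' Δ) (w : WS' φ) → restrict w ∈ restrictCtx ws
  restrict-∈ (here refl) (w' ∷ _) w = here (restrict-unique w w')
  restrict-∈ (there m) (_ ∷ ws) w = there (restrict-∈ m ws w)

  restrictTerm-id : ∀ {t i} (w : WellSortedTerm L₀ t i) → restrictTerm (wellSortedTerm-mono w) ≡ t
  restrictTerms-id : ∀ {ts is} (ws : Pointwise (WellSortedTerm L₀) ts is) →
                     restrictTerms (wellSortedTerms-mono ws) ≡ ts
  restrictTerm-id (var {i} s) with sort? i
  ... | yes _ = refl
  ... | no ¬s = ⊥-elim (¬s s)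
  restrictTerm-id (app {f} {is = is} {i} ρ ws) with rankF? f is i
  ... | yes _ = cong (app f) (restrictTerms-id ws)
  ... | no ¬ρ = ⊥-elim (¬ρ ρ)
  restrictTerms-id [] = refl
  restrictTerms-id (w ∷ ws) = cong₂ _∷_ (restrictTerm-id w) (restrictTerms-id ws)

  restrict-id : ∀ {φ} (w : WellSorted L₀ φ) → restrict (wellSorted-mono w) ≡ φ
  restrict-id ⊥' = refl
  restrict-id (eq {i = i} a b) with sort? i
  ... | yes _ = cong₂ _≐_ (restrictTerm-id a) (restrictTerm-id b)
  ... | no ¬s = ⊥-elim (¬s (wellSortedTerm-sort a))
  restrict-id (rel {R} {is = is} ρ ws) with rankR? R is
  ... | yes _ = cong (rel R) (restrictTerms-id ws)
  ... | no ¬ρ = ⊥-elim (¬ρ ρ)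
  restrict-id (and a b) = cong₂ _∧'_ (restrict-id a) (restrict-id b)
  restrict-id (or a b) = cong₂ _∨'_ (restrict-id a) (restrict-id b)
  restrict-id (imp a b) = cong₂ _⇒'_ (restrict-id a) (restrict-id b)
  restrict-id (ex {i} {n} s w) with sort? i
  ... | yes _ = cong (ex (i , n)) (restrict-id w)
  ... | no ¬s = ⊥-elim (¬s s)
  restrict-id (all {i} {n} s w) with sort? i
  ... | yes _ = cong (all (i , n)) (restrict-id w)
  ... | no ¬s = ⊥-elim (¬s s)

  restrictCtx-id : ∀ {Δ} (ws : All (WellSorted L₀) Δ) → restrictCtx (All.map wellSorted-mono ws) ≡ Δ
  restrictCtx-id [] = refl
  restrictCtx-id (w ∷ ws) = cong₂ _∷_ (restrict-id w) (restrictCtx-id ws)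

  restrictTerm-freeIn : ∀ {t i y} (w : WST' t i) → FreeInTerm y (restrictTerm w) →
                        (FreeInTerm y t × Sort L₀ (sortOf y)) ⊎ proj₂ y ≡ N
  restrictTerms-freeIn : ∀ {ts is y} (ws : Pointwise WST' ts is) → Any (FreeInTerm y) (restrictTerms ws) →
                         (Any (FreeInTerm y) ts × Sort L₀ (sortOf y)) ⊎ proj₂ y ≡ N
  restrictTerm-freeIn (var {i} _) a with sort? i
  restrictTerm-freeIn (var _) var | yes s = inj₁ (var , s)
  restrictTerm-freeIn (var _) var | no _ = inj₂ refl
  restrictTerm-freeIn (app {f} {is = is} {i} _ ws) a with rankF? f is i
  restrictTerm-freeIn (app _ ws) (app a) | yes _ = Sum.map₁ (Product.map₁ app) (restrictTerms-freeIn ws a)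
  restrictTerm-freeIn (app _ ws) var | no _ = inj₂ refl
  restrictTerms-freeIn (w ∷ ws) (here a) = Sum.map₁ (Product.map₁ here) (restrictTerm-freeIn w a)
  restrictTerms-freeIn (w ∷ ws) (there a) = Sum.map₁ (Product.map₁ there) (restrictTerms-freeIn ws a)

  restrict-freeIn : ∀ {φ y} (w : WS' φ) → FreeIn y (restrict w) →
                    (FreeIn y φ × Sort L₀ (sortOf y)) ⊎ proj₂ y ≡ N
  restrict-freeIn (eq {i = i} a b) fr with sort? i
  restrict-freeIn (eq a b) (eqˡ fr) | yes _ = Sum.map₁ (Product.map₁ eqˡ) (restrictTerm-freeIn a fr)
  restrict-freeIn (eq a b) (eqʳ fr) | yes _ = Sum.map₁ (Product.map₁ eqʳ) (restrictTerm-freeIn b fr)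
  restrict-freeIn (eq a b) (impˡ ()) | no _
  restrict-freeIn (eq a b) (impʳ ()) | no _
  restrict-freeIn (rel {R} {is = is} _ ws) fr with rankR? R is
  restrict-freeIn (rel _ ws) (rel fr) | yes _ = Sum.map₁ (Product.map₁ rel) (restrictTerms-freeIn ws fr)
  restrict-freeIn (rel _ ws) () | no _
  restrict-freeIn (and a b) (andˡ fr) = Sum.map₁ (Product.map₁ andˡ) (restrict-freeIn a fr)
  restrict-freeIn (and a b) (andʳ fr) = Sum.map₁ (Product.map₁ andʳ) (restrict-freeIn b fr)
  restrict-freeIn (or a b) (orˡ fr) = Sum.map₁ (Product.map₁ orˡ) (restrict-freeIn a fr)
  restrict-freeIn (or a b) (orʳ fr) = Sum.map₁ (Product.map₁ orʳ) (restrict-freeIn b fr)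
  restrict-freeIn (imp a b) (impˡ fr) = Sum.map₁ (Product.map₁ impˡ) (restrict-freeIn a fr)
  restrict-freeIn (imp a b) (impʳ fr) = Sum.map₁ (Product.map₁ impʳ) (restrict-freeIn b fr)
  restrict-freeIn (ex {i} _ w) fr with sort? i
  restrict-freeIn (ex _ w) (ex y≢x fr) | yes _ = Sum.map₁ (Product.map₁ (ex y≢x)) (restrict-freeIn w fr)
  restrict-freeIn (ex _ w) fr | no ¬s with restrict-freeIn w fr
  ... | inj₁ (fr' , s) = inj₁ (ex (λ { refl → ¬s s }) fr' , s)
  ... | inj₂ y≡N = inj₂ y≡N
  restrict-freeIn (all {i} _ w) fr with sort? i
  restrict-freeIn (all _ w) (all y≢x fr) | yes _ = Sum.map₁ (Product.map₁ (all y≢x)) (restrict-freeIn w fr)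
  restrict-freeIn (all _ w) fr | no ¬s with restrict-freeIn w fr
  ... | inj₁ (fr' , s) = inj₁ (all (λ { refl → ¬s s }) fr' , s)
  ... | inj₂ y≡N = inj₂ y≡N

  restrictTerm-notFree : ∀ {t i y} → proj₂ y ≢ N → ¬ FreeInTerm y t →
                         (w : WST' t i) → ¬ FreeInTerm y (restrictTerm w)
  restrictTerm-notFree y≢N y∉t w fr = Sum.[ (λ (fr' , _) → y∉t fr') , y≢N ] (restrictTerm-freeIn w fr)

  restrict-notFree : ∀ {φ y} → proj₂ y ≢ N → ¬ FreeIn y φ → (w : WS' φ) → ¬ FreeIn y (restrict w)
  restrict-notFree y≢N y∉φ w fr = Sum.[ (λ (fr' , _) → y∉φ fr') , y≢N ] (restrict-freeIn w fr)

  restrict-notFree-foreign : ∀ {φ y} → proj₂ y ≢ N → ¬ Sort L₀ (sortOf y) →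
                             (w : WS' φ) → ¬ FreeIn y (restrict w)
  restrict-notFree-foreign y≢N ¬s w fr = Sum.[ (λ (_ , s) → ¬s s) , y≢N ] (restrict-freeIn w fr)

  restrictCtx-notFree : ∀ {Δ y} → proj₂ y ≢ N → NotFreeInAll y Δ →
                        (ws : All WS' Δ) → NotFreeInAll y (restrictCtx ws)
  restrictCtx-notFree y≢N [] [] = []
  restrictCtx-notFree y≢N (y∉φ ∷ y∉Δ) (w ∷ ws) =
    restrict-notFree y≢N y∉φ w ∷ restrictCtx-notFree y≢N y∉Δ ws

  restrictTerm-foreign : ∀ {t i} (w : WST' t i) → ¬ Sort L₀ i → restrictTerm w ≡ dummy i
  restrictTerm-foreign (var {i} _) ¬s with sort? i
  ... | yes s = ⊥-elim (¬s s)
  ... | no _ = refl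
  restrictTerm-foreign (app {f} {is = is} {i} _ _) ¬s with rankF? f is i
  ... | yes ρ = ⊥-elim (¬s (proj₂ (rankF-sorts L₀ ρ)))
  ... | no _ = refl

  module _ {x : Var} {s : Term} (ws : WST' s (sortOf x)) (x≢N : proj₂ x ≢ N) where

    private
      dummy≢x : ∀ {j} → (j , N) ≢ x
      dummy≢x j,N≡x = x≢N (cong proj₂ (sym j,N≡x))

    restrictTerm-subst : ∀ {t i} (w : WST' t i) →
      restrictTerm (substT-wellSorted {x = x} ws w) ≡ substT (restrictTerm ws) x (restrictTerm w)
    restrictTerms-subst : ∀ {ts is} (w : Pointwise WST' ts is) →
      restrictTerms (substTs-wellSorted {x = x} ws w) ≡ substTs (restrictTerm ws) x (restrictTerms w)
    restrictTerm-subst (var {j} {n} _) with (j , n) ≟v x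
    ... | yes refl with sort? j
    ...   | yes _ = sym (substT-var-≡ _ _ _ refl)
    ...   | no ¬s = trans (restrictTerm-foreign ws ¬s) (sym (substT-var-≢ _ _ _ dummy≢x))
    restrictTerm-subst (var {j} {n} _) | no y≢x with sort? j
    ...   | yes _ = sym (substT-var-≢ _ _ _ y≢x)
    ...   | no _ = sym (substT-var-≢ _ _ _ dummy≢x)
    restrictTerm-subst (app {f} {is = is} {i} _ w) with rankF? f is i
    ... | yes _ = cong (app f) (restrictTerms-subst w)
    ... | no _ = sym (substT-var-≢ _ _ _ dummy≢x)
    restrictTerms-subst [] = refl
    restrictTerms-subst (w ∷ wts) = cong₂ _∷_ (restrictTerm-subst w) (restrictTerms-subst wts)

    restrict-subst : ∀ {φ} (w : WS' φ) →
      restrict (subst-wellSorted {x = x} ws w) ≡ restrict w [ restrictTerm ws / x ]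
    restrict-subst ⊥' = refl
    restrict-subst (eq {i = i} a b) with sort? i
    ... | yes _ = cong₂ _≐_ (restrictTerm-subst a) (restrictTerm-subst b)
    ... | no _ = refl
    restrict-subst (rel {R} {is = is} _ w) with rankR? R is
    ... | yes _ = cong (rel R) (restrictTerms-subst w)
    ... | no _ = refl
    restrict-subst (and a b) = cong₂ _∧'_ (restrict-subst a) (restrict-subst b)
    restrict-subst (or a b) = cong₂ _∨'_ (restrict-subst a) (restrict-subst b)
    restrict-subst (imp a b) = cong₂ _⇒'_ (restrict-subst a) (restrict-subst b)
    restrict-subst (ex {i} {n} _ w) with (i , n) ≟v x
    ... | yes refl with sort? i
    ...   | yes _ = sym (subst-ex-≡ _ _ _ _ refl)
    ...   | no ¬s = sym (subst-notFree _ _ _ (restrict-notFree-foreign x≢N ¬s w))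
    restrict-subst (ex {i} {n} _ w) | no y≢x with sort? i
    ...   | yes _ = trans (cong (ex (i , n)) (restrict-subst w)) (sym (subst-ex-≢ _ _ _ _ y≢x))
    ...   | no _ = restrict-subst w
    restrict-subst (all {i} {n} _ w) with (i , n) ≟v x
    ... | yes refl with sort? i
    ...   | yes _ = sym (subst-all-≡ _ _ _ _ refl)
    ...   | no ¬s = sym (subst-notFree _ _ _ (restrict-notFree-foreign x≢N ¬s w))
    restrict-subst (all {i} {n} _ w) | no y≢x with sort? i
    ...   | yes _ = trans (cong (all (i , n)) (restrict-subst w)) (sym (subst-all-≢ _ _ _ _ y≢x))
    ...   | no _ = restrict-subst w

    restrict-instance : ∀ {φ} (w : WS' φ) (w' : WS' (φ [ s / x ])) →
                        restrict w' ≡ restrict w [ restrictTerm ws / x ]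
    restrict-instance w w' = trans (restrict-unique w' (subst-wellSorted {x = x} ws w)) (restrict-subst w)

    restrict-freeFor : ∀ {φ} (w : WS' φ) → N ∉ indices φ → FreeFor s x φ →
                       FreeFor (restrictTerm ws) x (restrict w)
    restrict-freeFor ⊥' _ _ = tt
    restrict-freeFor (eq {i = i} _ _) _ _ with sort? i
    ... | yes _ = tt
    ... | no _ = tt , tt
    restrict-freeFor (rel {R} {is = is} _ _) _ _ with rankR? R is
    ... | yes _ = tt
    ... | no _ = tt
    restrict-freeFor (and {φ} a b) N∉ (fa , fb) =
      restrict-freeFor a (∉-++⁻ˡ N∉) fa , restrict-freeFor b (∉-++⁻ʳ (indices φ) N∉) fb
    restrict-freeFor (or {φ} a b) N∉ (fa , fb) =
      restrict-freeFor a (∉-++⁻ˡ N∉) fa , restrict-freeFor b (∉-++⁻ʳ (indices φ) N∉) fb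
    restrict-freeFor (imp {φ} a b) N∉ (fa , fb) =
      restrict-freeFor a (∉-++⁻ˡ N∉) fa , restrict-freeFor b (∉-++⁻ʳ (indices φ) N∉) fb
    restrict-freeFor (ex {i} _ w) N∉ ff with sort? i | ff
    ... | yes _ | inj₁ y≡x = inj₁ y≡x
    ... | yes _ | inj₂ (inj₁ x∉φ) = inj₂ (inj₁ (restrict-notFree x≢N x∉φ w))
    ... | yes _ | inj₂ (inj₂ (y∉s , ffφ)) =
      inj₂ (inj₂ (restrictTerm-notFree (∉-∷⁻ʰ N∉) y∉s ws , restrict-freeFor w (∉-∷⁻ᵗ N∉) ffφ))
    ... | no ¬s | inj₁ refl = freeFor-notFree _ _ _ (restrict-notFree-foreign x≢N ¬s w)
    ... | no _ | inj₂ (inj₁ x∉φ) = freeFor-notFree _ _ _ (restrict-notFree x≢N x∉φ w)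
    ... | no _ | inj₂ (inj₂ (_ , ffφ)) = restrict-freeFor w (∉-∷⁻ᵗ N∉) ffφ
    restrict-freeFor (all {i} _ w) N∉ ff with sort? i | ff
    ... | yes _ | inj₁ y≡x = inj₁ y≡x
    ... | yes _ | inj₂ (inj₁ x∉φ) = inj₂ (inj₁ (restrict-notFree x≢N x∉φ w))
    ... | yes _ | inj₂ (inj₂ (y∉s , ffφ)) =
      inj₂ (inj₂ (restrictTerm-notFree (∉-∷⁻ʰ N∉) y∉s ws , restrict-freeFor w (∉-∷⁻ᵗ N∉) ffφ))
    ... | no ¬s | inj₁ refl = freeFor-notFree _ _ _ (restrict-notFree-foreign x≢N ¬s w)
    ... | no _ | inj₂ (inj₁ x∉φ) = freeFor-notFree _ _ _ (restrict-notFree x≢N x∉φ w)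
    ... | no _ | inj₂ (inj₂ (_ , ffφ)) = restrict-freeFor w (∉-∷⁻ᵗ N∉) ffφ

  restrict-id′ : ∀ {φ} → WellSorted L₀ φ → (w : WS' φ) → restrict w ≡ φ
  restrict-id′ w₀ w = trans (restrict-unique w (wellSorted-mono w₀)) (restrict-id w₀)

  restrict-∀*-trivial : ∀ xs {χ} (w : WS' (∀* xs χ)) →
    (∀ (w' : WS' χ) → ∃ λ d → Trivial L₀ d (restrict w')) → ∃ λ d → Trivial L₀ d (restrict w)
  restrict-∀*-trivial [] w triv = triv w
  restrict-∀*-trivial ((i , _) ∷ xs) (all _ w) triv with sort? i | restrict-∀*-trivial xs w triv
  ... | yes _ | d , p = suc d , all p
  ... | no _ | dp = dp

  restrict-axiom : ∀ {φ} → EqualityAxiom L' φ → (w : WS' φ) → ∀ Δ → Deriv L₀ Δ (restrict w)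
  restrict-axiom (eq-refl {i} _) (all _ (eq (var _) (var _))) Δ with sort? i
  ... | yes s = axiom (equalityAxiom-wellSorted (eq-refl s)) (eq-refl s)
  ... | no _ = ⊤'-intro
  restrict-axiom (eq-sym {i} _) (all _ (all _ (imp (eq (var _) (var _)) (eq (var _) (var _))))) Δ
    with sort? i
  ... | yes s = axiom (equalityAxiom-wellSorted (eq-sym s)) (eq-sym s)
  ... | no _ = ⇒⊤'-intro (imp ⊥' ⊥')
  restrict-axiom (eq-trans {i} _)
                 (all _ (all _ (all _ (imp (and (eq (var _) (var _)) (eq (var _) (var _)))
                                           (eq (var _) (var _)))))) Δ with sort? i
  ... | yes s = axiom (equalityAxiom-wellSorted (eq-trans s)) (eq-trans s)
  ... | no _ = ⇒⊤'-intro (and (imp ⊥' ⊥') (imp ⊥' ⊥'))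
  restrict-axiom (eq-rel {R} {is} _) w Δ with rankR? R is
  ... | yes ρ₀ = subst (Deriv L₀ Δ) (sym (restrict-id′ ws₀ w)) (axiom ws₀ (eq-rel ρ₀))
    where ws₀ = equalityAxiom-wellSorted (eq-rel ρ₀)
  ... | no ¬ρ₀ = trivial-deriv (proj₂ triv) (restrict-wellSorted w) Δ
    where
    body : (w' : WS' (⋀ (eqs (xsFrom 0 is) (ysFrom 0 is)) ⇒'
                     (rel R (vars (xsFrom 0 is)) ⇒' rel R (vars (ysFrom 0 is))))) →
           ∃ λ d → Trivial L₀ d (restrict w')
    body (imp _ (imp (rel _ wxs) (rel _ wys)))
      with vars-sorts (xsFrom-sorts 0 is) wxs | vars-sorts (ysFrom-sorts 0 is) wys
    ... | refl | refl with rankR? R is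
    ...   | yes ρ₀ = ⊥-elim (¬ρ₀ ρ₀)
    ...   | no _ = 0 , ⇒⊤'
    triv = restrict-∀*-trivial (xsFrom 0 is) w (λ w' → restrict-∀*-trivial (ysFrom 0 is) w' body)
  restrict-axiom (eq-fun {f} {is} {i} ρ) w Δ with rankF? f is i
  ... | yes ρ₀ = subst (Deriv L₀ Δ) (sym (restrict-id′ ws₀ w)) (axiom ws₀ (eq-fun ρ₀))
    where ws₀ = equalityAxiom-wellSorted (eq-fun ρ₀)
  ... | no ¬ρ₀ = trivial-deriv (proj₂ triv) (restrict-wellSorted w) Δ
    where
    body : (w' : WS' (⋀ (eqs (xsFrom 0 is) (ysFrom 0 is)) ⇒'
                     (app f (vars (xsFrom 0 is)) ≐ app f (vars (ysFrom 0 is))))) →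
           ∃ λ d → Trivial L₀ d (restrict w')
    body (imp _ (eq (app ρ' wxs) (app _ wys)))
      with vars-sorts (xsFrom-sorts 0 is) wxs | vars-sorts (ysFrom-sorts 0 is) wys
    ... | refl | refl with rankF-partial L' ρ' ρ
    ...   | refl with sort? i | rankF? f is i
    ...     | _ | yes ρ₀ = ⊥-elim (¬ρ₀ ρ₀)
    ...     | yes s | no _ = 0 , ⇒≐-refl (var s)
    ...     | no _ | no _ = 0 , ⇒⊤'
    triv = restrict-∀*-trivial (xsFrom 0 is) w (λ w' → restrict-∀*-trivial (ysFrom 0 is) w' body)

  restrict-∀I : ∀ {Γ i n m φ} (s : Sort L' i) (w : WS' φ) → n ≢ N →
    FreeFor (restrictTerm (var {n = m} s)) (i , n) (restrict w) →
    ¬ FreeIn (i , m) (restrict (all {n = n} s w)) → NotFreeInAll (i , m) Γ →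
    Deriv L₀ Γ (restrict w [ restrictTerm (var {n = m} s) / (i , n) ]) →
    Deriv L₀ Γ (restrict (all {n = n} s w))
  restrict-∀I {i = i} s w n≢N ff nf nfΓ d with sort? i
  ... | yes s₀ = ∀I (all s₀ (restrict-wellSorted w)) refl ff nf nfΓ d
  ... | no ¬s = subst (Deriv L₀ _) (subst-notFree _ _ _ (restrict-notFree-foreign n≢N ¬s w)) d

  restrict-∀E : ∀ {Γ i n φ t} (s : Sort L' i) (w : WS' φ) (wt : WST' t i) → n ≢ N →
    FreeFor (restrictTerm wt) (i , n) (restrict w) →
    Deriv L₀ Γ (restrict (all {n = n} s w)) →
    Deriv L₀ Γ (restrict w [ restrictTerm wt / (i , n) ])
  restrict-∀E {i = i} s w wt n≢N ff d with sort? i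
  ... | yes s₀ = ∀E (subst-wellSorted wt₀ (restrict-wellSorted w)) wt₀ ff d
    where wt₀ = restrictTerm-wellSorted wt s₀
  ... | no ¬s = subst (Deriv L₀ _) (sym (subst-notFree _ _ _ (restrict-notFree-foreign n≢N ¬s w))) d

  restrict-∃I : ∀ {Γ i n φ t} (s : Sort L' i) (w : WS' φ) (wt : WST' t i) → n ≢ N →
    FreeFor (restrictTerm wt) (i , n) (restrict w) →
    Deriv L₀ Γ (restrict w [ restrictTerm wt / (i , n) ]) →
    Deriv L₀ Γ (restrict (ex {n = n} s w))
  restrict-∃I {i = i} s w wt n≢N ff d with sort? i
  ... | yes s₀ = ∃I (ex s₀ (restrict-wellSorted w)) (restrictTerm-wellSorted wt s₀) ff d
  ... | no ¬s = subst (Deriv L₀ _) (subst-notFree _ _ _ (restrict-notFree-foreign n≢N ¬s w)) d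

  restrict-∃E : ∀ {Γ i n m φ χ} (s : Sort L' i) (w : WS' φ) → WellSorted L₀ χ → n ≢ N →
    FreeFor (restrictTerm (var {n = m} s)) (i , n) (restrict w) →
    ¬ FreeIn (i , m) (restrict (ex {n = n} s w)) → ¬ FreeIn (i , m) χ → NotFreeInAll (i , m) Γ →
    Deriv L₀ Γ (restrict (ex {n = n} s w)) →
    Deriv L₀ ((restrict w [ restrictTerm (var {n = m} s) / (i , n) ]) ∷ Γ) χ →
    Deriv L₀ Γ χ
  restrict-∃E {Γ} {i} {χ = χ} s w wχ n≢N ff nf nfχ nfΓ d e with sort? i
  ... | yes s₀ = ∃E wχ refl ff nf nfχ nfΓ d e
  ... | no ¬s =
    ⇒E wχ (⇒I (imp (restrict-wellSorted w) wχ)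
              (subst (λ A → Deriv L₀ (A ∷ Γ) χ)
                     (subst-notFree _ _ _ (restrict-notFree-foreign n≢N ¬s w)) e))
       d

  restrict-deriv : ∀ {Δ φ} (D : Deriv L' Δ φ) → N ∉ derivIndices D →
                   (ws : All WS' Δ) (w : WS' φ) → Deriv L₀ (restrictCtx ws) (restrict w)
  restrict-deriv (assum _ m) _ ws w = assum (restrict-wellSorted w) (restrict-∈ m ws w)
  restrict-deriv (axiom _ a) _ ws w = restrict-axiom a w (restrictCtx ws)
  restrict-deriv (∧I _ d e) N∉ ws (and a b) =
    ∧I (restrict-wellSorted (and a b)) (restrict-deriv d (∉-++⁻ˡ N∉) ws a)
       (restrict-deriv e (∉-++⁻ʳ (derivIndices d) N∉) ws b)
  restrict-deriv (∧E₁ _ d) N∉ ws w with deriv-wellSorted d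
  ... | and _ b = ∧E₁ (restrict-wellSorted w) (restrict-deriv d N∉ ws (and w b))
  restrict-deriv (∧E₂ _ d) N∉ ws w with deriv-wellSorted d
  ... | and a _ = ∧E₂ (restrict-wellSorted w) (restrict-deriv d N∉ ws (and a w))
  restrict-deriv (∨I₁ _ d) N∉ ws (or a b) =
    ∨I₁ (restrict-wellSorted (or a b)) (restrict-deriv d N∉ ws a)
  restrict-deriv (∨I₂ _ d) N∉ ws (or a b) =
    ∨I₂ (restrict-wellSorted (or a b)) (restrict-deriv d N∉ ws b)
  restrict-deriv (∨E _ d e f) N∉ ws w with deriv-wellSorted d
  ... | or a b =
    ∨E (restrict-wellSorted w) (restrict-deriv d (∉-++⁻ˡ N∉) ws (or a b))
       (restrict-deriv e (∉-++⁻ˡ N∉ef) (a ∷ ws) w)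
       (restrict-deriv f (∉-++⁻ʳ (derivIndices e) N∉ef) (b ∷ ws) w)
    where N∉ef = ∉-++⁻ʳ (derivIndices d) N∉
  restrict-deriv (⇒I _ d) N∉ ws (imp a b) =
    ⇒I (restrict-wellSorted (imp a b)) (restrict-deriv d N∉ (a ∷ ws) b)
  restrict-deriv (⇒E _ d e) N∉ ws w with deriv-wellSorted d
  ... | imp a _ =
    ⇒E (restrict-wellSorted w) (restrict-deriv d (∉-++⁻ˡ N∉) ws (imp a w))
       (restrict-deriv e (∉-++⁻ʳ (derivIndices d) N∉) ws a)
  restrict-deriv (⊥E _ d) N∉ ws w = ⊥E (restrict-wellSorted w) (restrict-deriv d N∉ ws ⊥')
  restrict-deriv (RAA _ d) N∉ ws w = RAA (restrict-wellSorted w) (restrict-deriv d N∉ (imp w ⊥' ∷ ws) ⊥')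
  restrict-deriv (∀I {x = i , n} {_ , m} {φ} _ refl ff nf nfΔ d) N∉ ws (all s w) =
    restrict-∀I s w n≢N (restrict-freeFor (var s) n≢N w N∉φ ff) (restrict-notFree m≢N nf (all s w))
      (restrictCtx-notFree m≢N nfΔ ws)
      (subst (Deriv L₀ _) (restrict-instance {x = i , n} (var s) n≢N w (deriv-wellSorted d))
             (restrict-deriv d N∉d ws (deriv-wellSorted d)))
    where
    n≢N = ∉-∷⁻ʰ N∉
    m≢N = ∉-∷⁻ʰ (∉-∷⁻ᵗ N∉)
    N∉φ = ∉-++⁻ˡ (∉-∷⁻ᵗ (∉-∷⁻ᵗ N∉))
    N∉d = ∉-++⁻ʳ (indices φ) (∉-∷⁻ᵗ (∉-∷⁻ᵗ N∉))
  restrict-deriv (∀E {x = i , n} {φ} _ wt ff d) N∉ ws w with deriv-wellSorted d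
  ... | all s wφ =
    subst (Deriv L₀ _) (sym (restrict-instance {x = i , n} wt n≢N wφ w))
      (restrict-∀E s wφ wt n≢N (restrict-freeFor wt n≢N wφ (∉-++⁻ˡ (∉-∷⁻ᵗ N∉)) ff)
        (restrict-deriv d (∉-++⁻ʳ (indices φ) (∉-∷⁻ᵗ N∉)) ws (all s wφ)))
    where n≢N = ∉-∷⁻ʰ N∉
  restrict-deriv (∃I {x = i , n} {φ} _ wt ff d) N∉ ws (ex s w) =
    restrict-∃I s w wt n≢N (restrict-freeFor wt n≢N w (∉-++⁻ˡ (∉-∷⁻ᵗ N∉)) ff)
      (subst (Deriv L₀ _) (restrict-instance {x = i , n} wt n≢N w (deriv-wellSorted d))
             (restrict-deriv d (∉-++⁻ʳ (indices φ) (∉-∷⁻ᵗ N∉)) ws (deriv-wellSorted d)))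
    where n≢N = ∉-∷⁻ʰ N∉
  restrict-deriv (∃E {x = i , n} {_ , m} {φ} _ refl ff nf nfχ nfΔ d e) N∉ ws w with deriv-wellSorted d
  ... | ex s wφ =
    restrict-∃E s wφ (restrict-wellSorted w) n≢N (restrict-freeFor (var s) n≢N wφ N∉φ ff)
      (restrict-notFree m≢N nf (ex s wφ)) (restrict-notFree m≢N nfχ w) (restrictCtx-notFree m≢N nfΔ ws)
      (restrict-deriv d (∉-++⁻ˡ N∉de) ws (ex s wφ))
      (subst (λ A → Deriv L₀ (A ∷ restrictCtx ws) (restrict w)) (restrict-subst {x = i , n} (var s) n≢N wφ)
             (restrict-deriv e (∉-++⁻ʳ (derivIndices d) N∉de)
                             (subst-wellSorted {x = i , n} (var s) wφ ∷ ws) w))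
    where
    n≢N = ∉-∷⁻ʰ N∉
    m≢N = ∉-∷⁻ʰ (∉-∷⁻ᵗ N∉)
    N∉φ = ∉-++⁻ˡ (∉-∷⁻ᵗ (∉-∷⁻ᵗ N∉))
    N∉de = ∉-++⁻ʳ (indices φ) (∉-∷⁻ᵗ (∉-∷⁻ᵗ N∉))

conservative-over-decidable : ∀ {L₀ L' Δ φ} → DecidableSignature L₀ → L₀ ≤Sig L' →
  All (WellSorted L₀) Δ → WellSorted L₀ φ → Deriv L' Δ φ → Deriv L₀ Δ φ
conservative-over-decidable {L₀} dec L₀≤L' wsΔ wsφ D =
  subst₂ (Deriv L₀) (restrictCtx-id wsΔ) (restrict-id wsφ)
    (restrict-deriv D N∉D (All.map wellSorted-mono wsΔ) (wellSorted-mono wsφ))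
  where
  open Monotone L₀≤L'
  N∉D = proj₂ (fresh (derivIndices D))
  open Restriction L₀≤L' dec (proj₁ (fresh (derivIndices D)))

decidable-subsignature : ∀ {L Δ φ} → All (WellSorted L) Δ → WellSorted L φ →
  ∃ λ L₀ → DecidableSignature L₀ × L₀ ≤Sig L × All (WellSorted L₀) Δ × WellSorted L₀ φ
decidable-subsignature {L} wsΔ wsφ =
  fragmentSig c nonempty , fragmentSig-decidable c nonempty , fragmentSig≤ c nonempty ,
  ctx-wellSorted-fragment c nonempty wsΔ (∪-⊆ʳ (formulaFragment wsφ) c-rest) ,
  wellSorted-fragment c nonempty wsφ (∪-⊆ˡ (formulaFragment wsφ) c-rest)
  where
  s₀ = proj₂ (sort-nonempty L)
  c = sortFragment s₀ ∪ formulaFragment wsφ ∪ ctxFragment wsΔ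
  nonempty = proj₁ (sort-nonempty L) , here refl
  c-rest = ∪-⊆ʳ (sortFragment s₀) ⊆-refl

proposition2p10 : (L L' : Signature) → L ≤Sig L' →
    (Γ : Formula → Set) (φ : Formula) →
    (∀ ψ → Γ ψ → WellSorted L ψ) → WellSorted L φ →
    Γ ⊢[ L' ] φ → Γ ⊢[ L ] φ
proposition2p10 L L' L≤L' Γ φ wsΓ wsφ (Δ , Δ⊆Γ , D)
  with decidable-subsignature (All.map (wsΓ _) Δ⊆Γ) wsφ
... | L₀ , dec , L₀≤L , wsΔ₀ , wsφ₀ =
  Δ , Δ⊆Γ , Monotone.deriv-mono L₀≤L
              (conservative-over-decidable dec (≤Sig-trans L₀≤L L≤L') wsΔ₀ wsφ₀ D)
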